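{- Let $\ell$ be a prime, $X$ a finite multigraph with vertices $v_1,\dots,v_g$, and $\alpha:E_X^+\to\mathbb{Z}_\ell$ a function with $\alpha(\bar e)=-\alpha(e)$ for every directed edge $e$ with inverse $\bar e$. Then the Iwasawa polynomial $f_{X,\alpha}(T)$ is divisible by $T$ in $\mathbb{Z}_\ell[\![T]\!]$.
   Context: A multigraph $X$ consists of a finite vertex set $V_X$, a finite set $E_X^+$ of directed edges with source and target maps $o,t:E_X^+\to V_X$, and a fixed-point-free involution $e\mapsto\bar e$ on $E_X^+$ with $o(\bar e)=t(e)$, $t(\bar e)=o(e)$. The degree $\deg(v)$ is the number of directed edges with source $v$; $D_X$ is the diagonal matrix with entries $\deg(v_i)$. For $a\in\mathbb{Z}_\ell$, $(1+T)^a:=\sum_{k\ge0}\binom ak T^k\in\mathbb{Z}_\ell[\![T]\!]$. Define $M(1+T)=D_X-\Big(\sum_{e\in E_X^+,\,o(e)=v_i,\,t(e)=v_j}(1+T)^{\alpha(e)}\Big)_{i,j}$, and the Iwasawa polynomial $f_{X,\alpha}(T):=\det M(1+T)\in\mathbb{Z}_\ell[\![T]\!]$. -}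

module Defs where

open import Data.Nat as ℕ using (ℕ; zero; suc; _^_)
open import Data.Nat.Combinatorics using (_C_)
open import Data.Integer as ℤ using (ℤ; +_; -[1+_])
open import Data.Integer.Divisibility using (_∣_)
open import Data.Fin using (Fin; zero; suc; toℕ; punchIn; _≟_)
open import Data.Bool using (Bool; true; false; if_then_else_; _∧_)
open import Relation.Nullary.Decidable using (⌊_⌋)
open import Relation.Binary.PropositionalEquality using (_≡_; _≢_)

-- ℓ-adic integers, modelled by approximations: x n ∈ ℤ approximates
-- the ℓ-adic number modulo ℓ ^ n.

Adic : Set
Adic = ℕ → ℤ

IsAdic : ℕ → Adic → Set
IsAdic ℓ x = ∀ n → (+ (ℓ ^ n)) ∣ (x (suc n) ℤ.- x n)

Eqᵃ : ℕ → Adic → Adic → Set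
Eqᵃ ℓ x y = ∀ n → (+ (ℓ ^ n)) ∣ (x n ℤ.- y n)

0ᵃ 1ᵃ : Adic
0ᵃ _ = + 0
1ᵃ _ = + 1

ofℕᵃ : ℕ → Adic
ofℕᵃ k _ = + k

_+ᵃ_ _*ᵃ_ : Adic → Adic → Adic
(x +ᵃ y) n = x n ℤ.+ y n
(x *ᵃ y) n = x n ℤ.* y n

-ᵃ_ : Adic → Adic
(-ᵃ x) n = ℤ.- (x n)

binomℤ : ℤ → ℕ → ℤ
binomℤ (+ m) k = + (m C k)
binomℤ -[1+ m ] k = (ℤ.- (+ 1)) ℤ.^ k ℤ.* + ((m ℕ.+ k) C k)

-- ℓ-adic binomial coefficient (a choose k) ∈ ℤ_ℓ: since v_ℓ(k!) ≤ k,
-- (a choose k) mod ℓ^n is determined by a mod ℓ^(n+k).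
binomᵃ : Adic → ℕ → Adic
binomᵃ a k n = binomℤ (a (n ℕ.+ k)) k

Series : Set
Series = ℕ → Adic

Eqₛ : ℕ → Series → Series → Set
Eqₛ ℓ f h = ∀ k → Eqᵃ ℓ (f k) (h k)

IsSeries : ℕ → Series → Set
IsSeries ℓ f = ∀ k → IsAdic ℓ (f k)

0ₛ 1ₛ Tₛ : Series
0ₛ _ = 0ᵃ
1ₛ zero = 1ᵃ
1ₛ (suc _) = 0ᵃ
Tₛ zero = 0ᵃ
Tₛ (suc zero) = 1ᵃ
Tₛ (suc (suc _)) = 0ᵃ

constₛ : Adic → Series
constₛ a zero = a
constₛ a (suc _) = 0ᵃ

sumFinᵃ : ∀ n → (Fin n → Adic) → Adic
sumFinᵃ zero f = 0ᵃ
sumFinᵃ (suc n) f = f zero +ᵃ sumFinᵃ n (λ i → f (suc i))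

_+ₛ_ _*ₛ_ : Series → Series → Series
(f +ₛ h) k = f k +ᵃ h k
(f *ₛ h) k = sumFinᵃ (suc k) (λ i → f (toℕ i) *ᵃ h (k ℕ.∸ toℕ i))

-ₛ_ : Series → Series
(-ₛ f) k = -ᵃ (f k)

_-ₛ_ : Series → Series → Series
f -ₛ h = f +ₛ (-ₛ h)

sumFinₛ : ∀ n → (Fin n → Series) → Series
sumFinₛ zero f = 0ₛ
sumFinₛ (suc n) f = f zero +ₛ sumFinₛ n (λ i → f (suc i))

onePlusTPow : Adic → Series
onePlusTPow a k = binomᵃ a k

alt : ℕ → Series → Series
alt zero s = s
alt (suc k) s = -ₛ (alt k s)

det : ∀ n → (Fin n → Fin n → Series) → Series
det zero M = 1ₛ
det (suc n) M =
  sumFinₛ (suc n) (λ j → alt (toℕ j)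
    (M zero j *ₛ det n (λ a b → M (suc a) (punchIn j b))))

record Multigraph : Set where
  field
    g m : ℕ
    o t : Fin m → Fin g
    inv : Fin m → Fin m
    inv-inv : ∀ e → inv (inv e) ≡ e
    inv-nofix : ∀ e → inv e ≢ e
    o-inv : ∀ e → o (inv e) ≡ t e
    t-inv : ∀ e → t (inv e) ≡ o e

module _ (X : Multigraph) where
  open Multigraph X

  countFin : ∀ n → (Fin n → Bool) → ℕ
  countFin zero p = 0
  countFin (suc n) p = (if p zero then 1 else 0) ℕ.+ countFin n (λ i → p (suc i))

  deg : Fin g → ℕ
  deg v = countFin m (λ e → ⌊ o e ≟ v ⌋)

  iwasawaMatrix : (Fin m → Adic) → Fin g → Fin g → Series
  iwasawaMatrix α i j =
    constₛ (if ⌊ i ≟ j ⌋ then ofℕᵃ (deg i) else 0ᵃ)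
    -ₛ sumFinₛ m (λ e → if ⌊ o e ≟ i ⌋ ∧ ⌊ t e ≟ j ⌋ then onePlusTPow (α e) else 0ₛ)

  iwasawaPoly : (Fin m → Adic) → Series
  iwasawaPoly α = det g (iwasawaMatrix α)

-- The constant coefficient of f is det M(1), and (1+T)^a has constant coefficient 1 for every
-- a, so M(1) = D_X − A_X is the Laplacian of X: each row sums to deg vᵢ − deg vᵢ = 0, hence
-- f(0) = 0 and f = T·h with h = Σ_k f_{k+1} T^k.  That h lies in ℤ_ℓ[[T]] is the statement that
-- determinants, sums and products, and in particular ℓ-adic binomial coefficients, preserve
-- coherent approximation sequences.
module Submission where

open import Defs
open import Data.Nat as ℕ using (ℕ; zero; suc; _^_; _<_)
import Data.Nat.Properties as ℕₚ
open import Data.Nat.Combinatorics using (_C_; nCk+nC[k+1]≡[n+1]C[k+1]; nCn≡1)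
open import Data.Nat.Primality using (Prime)
open import Data.Integer as ℤ using (ℤ; +_; -[1+_]; 0ℤ; 1ℤ; -1ℤ; _+_; _-_; _*_; -_)
import Data.Integer.Properties as ℤₚ
open import Data.Integer.Divisibility.Signed
  using (_∣_; divides; ∣m⇒∣-m; ∣m∣n⇒∣m+n; ∣n⇒∣m*n; ∣m⇒∣m*n; *-monoʳ-∣; ∣ᵤ⇒∣; ∣⇒∣ᵤ)
open import Data.Integer.Tactic.RingSolver using (solve-∀)
open import Data.Fin using (Fin; zero; suc; toℕ; punchIn; punchOut; _≟_)
open import Data.Fin.Properties using (punchInᵢ≢i; punchIn-punchOut; punchIn-injective)
open import Data.Vec.Functional using (Vector)
open import Data.Bool using (Bool; true; false; if_then_else_; _∧_)
open import Data.Product using (Σ; _×_; _,_)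
open import Data.Sum using (_⊎_; inj₁; inj₂)
open import Data.Empty using (⊥-elim)
open import Algebra.Properties.CommutativeMonoid.Sum ℤₚ.+-0-commutativeMonoid
  using (sum; sum-cong-≗; sum-remove; sum-replicate-zero; ∑-distrib-+; ∑-comm)
open import Algebra.Properties.AbelianGroup ℤₚ.+-0-abelianGroup
  using (identityʳ-unique; inverseʳ-unique)
open import Relation.Binary.Construct.Closure.Transitive using (TransClosure; [_]; _∷_)
open import Relation.Nullary using (Dec; yes; no)
open import Relation.Nullary.Decidable using (⌊_⌋; isYes≗does; dec-true; dec-false)
open import Function using (_∘_)
open import Relation.Binary.PropositionalEquality

private variable
  n : ℕ

-- Congruences and periodicity

infix 4 _≈_mod_
record _≈_mod_ (x y M : ℤ) : Set where
  constructor mk≈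
  field divides-difference : M ∣ x - y
open _≈_mod_ public

module _ {M : ℤ} where

  mk≈-via : ∀ {x y d} → x - y ≡ d → M ∣ d → x ≈ y mod M
  mk≈-via eq M∣d = mk≈ (subst (M ∣_) (sym eq) M∣d)

  mod-reflexive : ∀ {x y} → x ≡ y → x ≈ y mod M
  mod-reflexive {x} refl = mk≈ (divides 0ℤ (trans (ℤₚ.+-inverseʳ x) (sym (ℤₚ.*-zeroˡ M))))

  mod-refl : ∀ {x} → x ≈ x mod M
  mod-refl = mod-reflexive refl

  mod-sym : ∀ {x y} → x ≈ y mod M → y ≈ x mod M
  mod-sym {x} {y} (mk≈ p) = mk≈-via (e x y) (∣m⇒∣-m p)
    where e : ∀ x y → y - x ≡ - (x - y)
          e = solve-∀

  mod-trans : ∀ {x y z} → x ≈ y mod M → y ≈ z mod M → x ≈ z mod M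
  mod-trans {x} {y} {z} (mk≈ p) (mk≈ q) = mk≈-via (e x y z) (∣m∣n⇒∣m+n p q)
    where e : ∀ x y z → x - z ≡ (x - y) + (y - z)
          e = solve-∀

  mod-+ : ∀ {x y u v} → x ≈ y mod M → u ≈ v mod M → x + u ≈ y + v mod M
  mod-+ {x} {y} {u} {v} (mk≈ p) (mk≈ q) = mk≈-via (e x y u v) (∣m∣n⇒∣m+n p q)
    where e : ∀ x y u v → (x + u) - (y + v) ≡ (x - y) + (u - v)
          e = solve-∀

  mod-neg : ∀ {x y} → x ≈ y mod M → - x ≈ - y mod M
  mod-neg {x} {y} (mk≈ p) = mk≈-via (e x y) (∣m⇒∣-m p)
    where e : ∀ x y → - x - - y ≡ - (x - y)
          e = solve-∀

  mod-* : ∀ {x y u v} → x ≈ y mod M → u ≈ v mod M → x * u ≈ y * v mod M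
  mod-* {x} {y} {u} {v} (mk≈ p) (mk≈ q) =
    mk≈-via (e x y u v) (∣m∣n⇒∣m+n (∣n⇒∣m*n x q) (∣m⇒∣m*n v p))
    where e : ∀ x y u v → x * u - y * v ≡ x * (u - v) + (x - y) * v
          e = solve-∀

  ∣⇒≈0 : ∀ {x} → M ∣ x → x ≈ 0ℤ mod M
  ∣⇒≈0 {x} = mk≈-via (ℤₚ.+-identityʳ x)

  ≈0⇒≈ : ∀ {x y} → x - y ≈ 0ℤ mod M → x ≈ y mod M
  ≈0⇒≈ {x} {y} (mk≈ p) = mk≈-via (sym (ℤₚ.+-identityʳ (x - y))) p

Periodic : ℤ → ℤ → (ℤ → ℤ) → Set
Periodic M s f = ∀ y → f (y + s) ≈ f y mod M

Δ : ℕ → (ℤ → ℤ) → ℤ → ℤ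
Δ s f y = f (y + + s) - f y

module _ {M : ℤ} where

  periodic-multiple : ∀ {f s} → Periodic M (+ s) f → ∀ j → Periodic M (+ (j ℕ.* s)) f
  periodic-multiple {f} p zero y = mod-reflexive (cong f (ℤₚ.+-identityʳ y))
  periodic-multiple {f} {s} p (suc j) y =
    mod-trans (mod-reflexive (cong f (e y (+ s) (+ (j ℕ.* s)))))
              (mod-trans (p (y + + (j ℕ.* s))) (periodic-multiple p j y))
    where e : ∀ y s t → y + (s + t) ≡ (y + t) + s
          e = solve-∀

  periodic-shift : ∀ {f} → Periodic M 1ℤ f → ∀ t → Periodic M (+ t) f
  periodic-shift {f} p t = subst (λ s → Periodic M (+ s) f) (ℕₚ.*-identityʳ t) (periodic-multiple p t)

  periodic⇒mod : ∀ {f s x y} → Periodic M (+ s) f → y ≈ x mod + s → f y ≈ f x mod M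
  periodic⇒mod {f} {s} {x} {y} p (mk≈ (divides (+ t) y-x≡t*s)) =
    subst (λ z → f z ≈ f x mod M) (sym y≡) (periodic-multiple p t x)
    where
    e : ∀ x y → y ≡ x + (y - x)
    e = solve-∀
    y≡ : y ≡ x + + (t ℕ.* s)
    y≡ = trans (e x y) (cong (_+_ x) (trans y-x≡t*s (sym (ℤₚ.pos-* t s))))
  periodic⇒mod {f} {s} {x} {y} p (mk≈ (divides -[1+ t ] y-x≡-t*s)) =
    mod-sym (subst (λ z → f z ≈ f y mod M) (sym x≡) (periodic-multiple p (suc t) y))
    where
    open ≡-Reasoning
    e : ∀ x y → x ≡ y + - (y - x)
    e = solve-∀
    x≡ : x ≡ y + + (suc t ℕ.* s)
    x≡ = begin
      x                         ≡⟨ e x y ⟩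
      y + - (y - x)             ≡⟨ cong (λ z → y + - z) y-x≡-t*s ⟩
      y + - (-[1+ t ] * + s)    ≡⟨ cong (_+_ y) (ℤₚ.neg-distribˡ-* -[1+ t ] (+ s)) ⟩
      y + + suc t * + s         ≡⟨ cong (_+_ y) (ℤₚ.pos-* (suc t) s) ⟨
      y + + (suc t ℕ.* s)       ∎

  telescope : ∀ {f s} → Periodic M 1ℤ (Δ s f) →
              ∀ j x → f (x + + (j ℕ.* s)) - f x ≈ + j * Δ s f x mod M
  telescope {f} {s} p zero x = mod-reflexive (begin
    f (x + 0ℤ) - f x  ≡⟨ cong (λ z → f z - f x) (ℤₚ.+-identityʳ x) ⟩
    f x - f x         ≡⟨ ℤₚ.+-inverseʳ (f x) ⟩
    0ℤ                ≡⟨ ℤₚ.*-zeroˡ (Δ s f x) ⟨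
    0ℤ * Δ s f x      ∎)
    where open ≡-Reasoning
  telescope {f} {s} p (suc j) x =
    mod-trans (mod-reflexive split)
      (mod-trans (mod-+ (periodic-shift p (j ℕ.* s) x) (telescope {f} p j x))
                 (mod-reflexive (e (+ j) (Δ s f x))))
    where
    open ≡-Reasoning
    xⱼ = x + + (j ℕ.* s)
    e′ : ∀ x s t → x + (s + t) ≡ (x + t) + s
    e′ = solve-∀
    e″ : ∀ a b c → a - c ≡ (a - b) + (b - c)
    e″ = solve-∀
    split : f (x + + (suc j ℕ.* s)) - f x ≡ Δ s f xⱼ + (f xⱼ - f x)
    split = begin
      f (x + + (s ℕ.+ j ℕ.* s)) - f x  ≡⟨ cong (λ z → f z - f x) (e′ x (+ s) (+ (j ℕ.* s))) ⟩
      f (xⱼ + + s) - f x               ≡⟨ e″ (f (xⱼ + + s)) (f xⱼ) (f x) ⟩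
      Δ s f xⱼ + (f xⱼ - f x)          ∎
    e : ∀ j d → d + j * d ≡ (1ℤ + j) * d
    e = solve-∀

-- ℓ-adic binomial coefficients

binomℤ-0 : ∀ x → binomℤ x 0 ≡ 1ℤ
binomℤ-0 (+ m) = refl
binomℤ-0 -[1+ m ] = refl

binomℤ-pascal : ∀ x k → binomℤ (x + 1ℤ) (suc k) ≡ binomℤ x (suc k) + binomℤ x k
binomℤ-pascal (+ m) k = begin
  + ((m ℕ.+ 1) C suc k)        ≡⟨ cong (λ n → + (n C suc k)) (ℕₚ.+-comm m 1) ⟩
  + (suc m C suc k)            ≡⟨ cong +_ (nCk+nC[k+1]≡[n+1]C[k+1] m k) ⟨
  + (m C k ℕ.+ m C suc k)      ≡⟨ cong +_ (ℕₚ.+-comm (m C k) _) ⟩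
  + (m C suc k) + + (m C k)    ∎
  where open ≡-Reasoning
binomℤ-pascal -[1+ zero ] k = begin
  0ℤ                                            ≡⟨ e σ ⟩
  -1ℤ * σ * 1ℤ + σ * 1ℤ                         ≡⟨ cong₂ (λ a b → -1ℤ * σ * + a + σ * + b)
                                                         (nCn≡1 (suc k)) (nCn≡1 k) ⟨
  -1ℤ * σ * + (suc k C suc k) + σ * + (k C k)   ∎
  where
  open ≡-Reasoning
  σ = -1ℤ ℤ.^ k
  e : ∀ σ → 0ℤ ≡ -1ℤ * σ * 1ℤ + σ * 1ℤ
  e = solve-∀
binomℤ-pascal -[1+ suc m ] k = begin
  -1ℤ * σ * + ((m ℕ.+ suc k) C suc k)
    ≡⟨ cong (λ n → -1ℤ * σ * + (n C suc k)) (ℕₚ.+-suc m k) ⟩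
  -1ℤ * σ * + b
    ≡⟨ e σ (+ a) (+ b) ⟩
  -1ℤ * σ * (+ a + + b) + σ * + a
    ≡⟨ cong (λ n → -1ℤ * σ * + n + σ * + a) (nCk+nC[k+1]≡[n+1]C[k+1] (suc (m ℕ.+ k)) k) ⟩
  -1ℤ * σ * + (suc (suc (m ℕ.+ k)) C suc k) + σ * + a
    ≡⟨ cong (λ n → -1ℤ * σ * + (suc n C suc k) + σ * + a) (ℕₚ.+-suc m k) ⟨
  -1ℤ * σ * + ((suc m ℕ.+ suc k) C suc k) + σ * + a
    ∎
  where
  open ≡-Reasoning
  σ = -1ℤ ℤ.^ k
  a = suc (m ℕ.+ k) C k
  b = suc (m ℕ.+ k) C suc k
  e : ∀ σ a b → -1ℤ * σ * b ≡ -1ℤ * σ * (a + b) + σ * a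
  e = solve-∀

module _ (ℓ : ℕ) where

  -- With s = ℓ^(m+1+k): by Pascal, Δ s B(y+1) − Δ s B(y) is the k-th binomial difference, which the
  -- induction hypothesis makes ≡ 0 mod ℓ^(m+1); telescoping ℓ steps of size s then gives
  -- B(y + ℓs) − B(y) ≡ ℓ · Δ s B(y), and Δ s B(y) ≡ 0 mod ℓ^m by the hypothesis for (k+1, m).
  binomℤ-periodic : ∀ k m → Periodic (+ (ℓ ^ m)) (+ (ℓ ^ (m ℕ.+ k))) (λ y → binomℤ y k)
  binomℤ-periodic zero m y = mod-reflexive (trans (binomℤ-0 (y + + (ℓ ^ (m ℕ.+ 0)))) (sym (binomℤ-0 y)))
  binomℤ-periodic (suc k) zero y =
    mk≈ (divides (binomℤ (y + + (ℓ ^ suc k)) (suc k) - binomℤ y (suc k)) (sym (ℤₚ.*-identityʳ _)))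
  binomℤ-periodic (suc k) (suc m) y =
    subst (λ t → B (y + + t) ≈ B y mod + (ℓ ^ suc m)) (sym exponent)
      (≈0⇒≈ (mod-trans (telescope {f = B} Δ-periodic ℓ y) (∣⇒≈0 ℓΔ-divisible)))
    where
    B : ℤ → ℤ
    B x = binomℤ x (suc k)
    s = ℓ ^ (suc m ℕ.+ k)
    exponent : ℓ ^ (suc m ℕ.+ suc k) ≡ ℓ ℕ.* s
    exponent = cong (λ e → ℓ ℕ.* ℓ ^ e) (ℕₚ.+-suc m k)
    Δ-periodic : Periodic (+ (ℓ ^ suc m)) 1ℤ (Δ s B)
    Δ-periodic x = mk≈-via pascal-difference (divides-difference (binomℤ-periodic k (suc m) x))
      where
      open ≡-Reasoning
      e : ∀ a b c d → (a + b) - (c + d) - (a - c) ≡ b - d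
      e = solve-∀
      e′ : ∀ x s → (x + 1ℤ) + s ≡ (x + s) + 1ℤ
      e′ = solve-∀
      pascal-difference : Δ s B (x + 1ℤ) - Δ s B x ≡ binomℤ (x + + s) k - binomℤ x k
      pascal-difference = begin
        B ((x + 1ℤ) + + s) - B (x + 1ℤ) - Δ s B x
          ≡⟨ cong (λ z → B z - B (x + 1ℤ) - Δ s B x) (e′ x (+ s)) ⟩
        B ((x + + s) + 1ℤ) - B (x + 1ℤ) - Δ s B x
          ≡⟨ cong₂ (λ u v → u - v - Δ s B x) (binomℤ-pascal (x + + s) k) (binomℤ-pascal x k) ⟩
        (B (x + + s) + binomℤ (x + + s) k) - (B x + binomℤ x k) - Δ s B x
          ≡⟨ e (B (x + + s)) (binomℤ (x + + s) k) (B x) (binomℤ x k) ⟩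
        binomℤ (x + + s) k - binomℤ x k
          ∎
    ℓΔ-divisible : + (ℓ ^ suc m) ∣ + ℓ * Δ s B y
    ℓΔ-divisible = subst (_∣ + ℓ * Δ s B y) (sym (ℤₚ.pos-* ℓ (ℓ ^ m)))
      (*-monoʳ-∣ (+ ℓ) (subst (λ t → + (ℓ ^ m) ∣ B (y + + t) - B y) (cong (ℓ ^_) (ℕₚ.+-suc m k))
        (divides-difference (binomℤ-periodic (suc k) m y))))

  binomℤ-mod : ∀ {k m x y} → y ≈ x mod + (ℓ ^ (m ℕ.+ k)) → binomℤ y k ≈ binomℤ x k mod + (ℓ ^ m)
  binomℤ-mod {k} {m} = periodic⇒mod (binomℤ-periodic k m)

-- Coherent sequences

Coherent : ℕ → Adic → Set
Coherent ℓ x = ∀ n → x (suc n) ≈ x n mod + (ℓ ^ n)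

Coherentₛ : ℕ → Series → Set
Coherentₛ ℓ f = ∀ k → Coherent ℓ (f k)

module _ {ℓ : ℕ} where

  isAdic⇒coherent : ∀ {x} → IsAdic ℓ x → Coherent ℓ x
  isAdic⇒coherent p n = mk≈ (∣ᵤ⇒∣ (p n))

  coherentₛ⇒isSeries : ∀ {f} → Coherentₛ ℓ f → IsSeries ℓ f
  coherentₛ⇒isSeries p k n = ∣⇒∣ᵤ (divides-difference (p k n))

  coherent-const : ∀ c → Coherent ℓ (λ _ → c)
  coherent-const c n = mod-refl

  coherent-+ : ∀ {x y} → Coherent ℓ x → Coherent ℓ y → Coherent ℓ (x +ᵃ y)
  coherent-+ p q n = mod-+ (p n) (q n)

  coherent-* : ∀ {x y} → Coherent ℓ x → Coherent ℓ y → Coherent ℓ (x *ᵃ y)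
  coherent-* p q n = mod-* (p n) (q n)

  coherent-neg : ∀ {x} → Coherent ℓ x → Coherent ℓ (-ᵃ x)
  coherent-neg p n = mod-neg (p n)

  coherent-sumFin : ∀ n {x : Fin n → Adic} → (∀ i → Coherent ℓ (x i)) → Coherent ℓ (sumFinᵃ n x)
  coherent-sumFin zero p = coherent-const 0ℤ
  coherent-sumFin (suc n) p = coherent-+ (p zero) (coherent-sumFin n (p ∘ suc))

  coherent-binom : ∀ {a} → Coherent ℓ a → ∀ k → Coherent ℓ (binomᵃ a k)
  coherent-binom p k n = binomℤ-mod ℓ {m = n} (p (n ℕ.+ k))

  coherentₛ-0 : Coherentₛ ℓ 0ₛ
  coherentₛ-0 k = coherent-const 0ℤ

  coherentₛ-1 : Coherentₛ ℓ 1ₛ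
  coherentₛ-1 zero = coherent-const 1ℤ
  coherentₛ-1 (suc k) = coherent-const 0ℤ

  coherentₛ-const : ∀ {a} → Coherent ℓ a → Coherentₛ ℓ (constₛ a)
  coherentₛ-const p zero = p
  coherentₛ-const p (suc k) = coherent-const 0ℤ

  coherentₛ-+ : ∀ {f g} → Coherentₛ ℓ f → Coherentₛ ℓ g → Coherentₛ ℓ (f +ₛ g)
  coherentₛ-+ p q k = coherent-+ (p k) (q k)

  coherentₛ-neg : ∀ {f} → Coherentₛ ℓ f → Coherentₛ ℓ (-ₛ f)
  coherentₛ-neg p k = coherent-neg (p k)

  coherentₛ-* : ∀ {f g} → Coherentₛ ℓ f → Coherentₛ ℓ g → Coherentₛ ℓ (f *ₛ g)
  coherentₛ-* p q k = coherent-sumFin (suc k) (λ i → coherent-* (p (toℕ i)) (q (k ℕ.∸ toℕ i)))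

  coherentₛ-sumFin : ∀ n {f : Fin n → Series} → (∀ i → Coherentₛ ℓ (f i)) → Coherentₛ ℓ (sumFinₛ n f)
  coherentₛ-sumFin zero p = coherentₛ-0
  coherentₛ-sumFin (suc n) p = coherentₛ-+ (p zero) (coherentₛ-sumFin n (p ∘ suc))

  coherentₛ-alt : ∀ j {f} → Coherentₛ ℓ f → Coherentₛ ℓ (alt j f)
  coherentₛ-alt zero p = p
  coherentₛ-alt (suc j) p = coherentₛ-neg (coherentₛ-alt j p)

  coherentₛ-det : ∀ n {M : Fin n → Fin n → Series} → (∀ i j → Coherentₛ ℓ (M i j)) →
                  Coherentₛ ℓ (det n M)
  coherentₛ-det zero p = coherentₛ-1
  coherentₛ-det (suc n) p = coherentₛ-sumFin (suc n) (λ j →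
    coherentₛ-alt (toℕ j) (coherentₛ-* (p zero j) (coherentₛ-det n (λ a b → p (suc a) (punchIn j b)))))

-- Integer determinants

sum-zero : (f : Vector ℤ n) → (∀ k → f k ≡ 0ℤ) → sum f ≡ 0ℤ
sum-zero {n} f f≡0 = trans (sum-cong-≗ f≡0) (sum-replicate-zero n)

punchIn-≢ : ∀ {i j : Fin (suc n)} (i≢j : i ≢ j) {k} → k ≢ punchOut i≢j → punchIn i k ≢ j
punchIn-≢ {i = i} i≢j {k} k≢j′ eq = k≢j′ (punchIn-injective i k _ (trans eq (sym (punchIn-punchOut i≢j))))

sum-single : ∀ (f : Vector ℤ n) p → (∀ k → k ≢ p → f k ≡ 0ℤ) → sum f ≡ f p
sum-single {suc n} f p f≡0 = begin
  sum f                        ≡⟨ sum-remove {i = p} f ⟩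
  f p + sum (f ∘ punchIn p)    ≡⟨ cong (_+_ (f p)) (sum-zero _ (λ k → f≡0 (punchIn p k) (punchInᵢ≢i p k))) ⟩
  f p + 0ℤ                     ≡⟨ ℤₚ.+-identityʳ (f p) ⟩
  f p                          ∎
  where open ≡-Reasoning

sum-pair : ∀ (f : Vector ℤ n) {p q} → p ≢ q → (∀ k → k ≢ p → k ≢ q → f k ≡ 0ℤ) → sum f ≡ f p + f q
sum-pair {suc n} f {p} {q} p≢q f≡0 = begin
  sum f                                ≡⟨ sum-remove {i = p} f ⟩
  f p + sum (f ∘ punchIn p)            ≡⟨ cong (_+_ (f p)) (sum-single (f ∘ punchIn p) (punchOut p≢q)
                                            (λ k k≢ → f≡0 (punchIn p k) (punchInᵢ≢i p k) (punchIn-≢ p≢q k≢))) ⟩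
  f p + f (punchIn p (punchOut p≢q))   ≡⟨ cong (λ j → f p + f j) (punchIn-punchOut p≢q) ⟩
  f p + f q                            ∎
  where open ≡-Reasoning

sum-neg : (f : Vector ℤ n) → sum (λ i → - f i) ≡ - sum f
sum-neg {zero} f = refl
sum-neg {suc n} f = trans (cong (_+_ (- f zero)) (sum-neg (f ∘ suc))) (sym (ℤₚ.neg-distrib-+ (f zero) _))

Matrix : ℕ → Set
Matrix n = Fin n → Fin n → ℤ

minor : Matrix (suc n) → Fin (suc n) → Matrix n
minor A j a b = A (suc a) (punchIn j b)

detℤ : ∀ n → Matrix n → ℤ
detℤ zero A = 1ℤ
detℤ (suc n) A = sum (λ j → -1ℤ ℤ.^ toℕ j * (A zero j * detℤ n (minor A j)))

detℤ-cong : ∀ {A B : Matrix n} → (∀ i j → A i j ≡ B i j) → detℤ n A ≡ detℤ n B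
detℤ-cong {zero} A≡B = refl
detℤ-cong {suc n} A≡B = sum-cong-≗ (λ j → cong₂ (λ a d → -1ℤ ℤ.^ toℕ j * (a * d))
  (A≡B zero j) (detℤ-cong (λ a b → A≡B (suc a) (punchIn j b))))

AgreeOutside : Fin n → Matrix n → Matrix n → Set
AgreeOutside c A B = ∀ i j → j ≢ c → A i j ≡ B i j

agreeOutside-minor : ∀ {A B : Matrix (suc n)} {c k} (k≢c : k ≢ c) → AgreeOutside c A B →
                     AgreeOutside (punchOut k≢c) (minor A k) (minor B k)
agreeOutside-minor {k = k} k≢c A≈B a b b≢c′ = A≈B (suc a) (punchIn k b) (punchIn-≢ k≢c b≢c′)

detℤ-additive : ∀ {A A₁ A₂ : Matrix n} c → AgreeOutside c A A₁ → AgreeOutside c A A₂ →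
                (∀ i → A i c ≡ A₁ i c + A₂ i c) → detℤ n A ≡ detℤ n A₁ + detℤ n A₂
detℤ-additive {suc n} {A} {A₁} {A₂} c A≈A₁ A≈A₂ A≡A₁+A₂ =
  trans (sum-cong-≗ term-additive) (∑-distrib-+ (term A₁) (term A₂))
  where
  term : Matrix (suc n) → Fin (suc n) → ℤ
  term B k = -1ℤ ℤ.^ toℕ k * (B zero k * detℤ n (minor B k))
  term-additive : ∀ k → term A k ≡ term A₁ k + term A₂ k
  term-additive k with k ≟ c
  ... | yes refl = trans (cong (-1ℤ ℤ.^ toℕ k *_) split) (ℤₚ.*-distribˡ-+ (-1ℤ ℤ.^ toℕ k) _ _)
    where
    same-minors : ∀ {B} → AgreeOutside c A B → detℤ n (minor A k) ≡ detℤ n (minor B k)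
    same-minors A≈B = detℤ-cong (λ a b → A≈B (suc a) (punchIn k b) (punchInᵢ≢i k b))
    split : A zero k * detℤ n (minor A k) ≡ A₁ zero k * detℤ n (minor A₁ k) + A₂ zero k * detℤ n (minor A₂ k)
    split rewrite A≡A₁+A₂ zero | sym (same-minors A≈A₁) | sym (same-minors A≈A₂) =
      ℤₚ.*-distribʳ-+ _ (A₁ zero k) (A₂ zero k)
  ... | no k≢c = trans (cong (-1ℤ ℤ.^ toℕ k *_) split) (ℤₚ.*-distribˡ-+ (-1ℤ ℤ.^ toℕ k) _ _)
    where
    minors-additive : detℤ n (minor A k) ≡ detℤ n (minor A₁ k) + detℤ n (minor A₂ k)
    minors-additive =
      detℤ-additive (punchOut k≢c) (agreeOutside-minor k≢c A≈A₁) (agreeOutside-minor k≢c A≈A₂)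
        (λ a → subst (λ j → A (suc a) j ≡ A₁ (suc a) j + A₂ (suc a) j) (sym (punchIn-punchOut k≢c))
                     (A≡A₁+A₂ (suc a)))
    split : A zero k * detℤ n (minor A k) ≡ A₁ zero k * detℤ n (minor A₁ k) + A₂ zero k * detℤ n (minor A₂ k)
    split rewrite minors-additive | sym (A≈A₁ zero k k≢c) | sym (A≈A₂ zero k k≢c) =
      ℤₚ.*-distribˡ-+ (A zero k) _ _

detℤ-zeroColumn : ∀ {A : Matrix n} c → (∀ i → A i c ≡ 0ℤ) → detℤ n A ≡ 0ℤ
detℤ-zeroColumn {n} {A} c A≡0 = identityʳ-unique (detℤ n A) (detℤ n A) (sym doubled)
  where
  doubled : detℤ n A ≡ detℤ n A + detℤ n A
  doubled = detℤ-additive c (λ _ _ _ → refl) (λ _ _ _ → refl) (λ i → subst (λ x → x ≡ x + x) (sym (A≡0 i)) refl)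

column : Matrix n → Fin n → Vector ℤ n
column A c i = A i c

replaceColumn : Matrix n → Fin n → Vector ℤ n → Matrix n
replaceColumn A c u i j with j ≟ c
... | yes _ = u i
... | no _ = A i j

replaceColumn-≡ : ∀ (A : Matrix n) c u i → replaceColumn A c u i c ≡ u i
replaceColumn-≡ A c u i with c ≟ c
... | yes _ = refl
... | no c≢c = ⊥-elim (c≢c refl)

replaceColumn-≢ : ∀ (A : Matrix n) c u → AgreeOutside c (replaceColumn A c u) A
replaceColumn-≢ A c u i j j≢c with j ≟ c
... | yes j≡c = ⊥-elim (j≢c j≡c)
... | no _ = refl

replaceColumn-self : ∀ (A : Matrix n) c u → (∀ i → u i ≡ A i c) → ∀ i j → replaceColumn A c u i j ≡ A i j
replaceColumn-self A c u u≡A i j with j ≟ c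
... | yes refl = u≡A i
... | no _ = refl

detℤ-sumColumn : ∀ {m} {A : Matrix n} c (B : Fin m → Matrix n) → (∀ k → AgreeOutside c A (B k)) →
                 (∀ i → A i c ≡ sum (λ k → B k i c)) → detℤ n A ≡ sum (λ k → detℤ n (B k))
detℤ-sumColumn {m = zero} c B A≈B A≡∑B = detℤ-zeroColumn c A≡∑B
detℤ-sumColumn {n} {suc m} {A} c B A≈B A≡∑B = begin
  detℤ n A
    ≡⟨ detℤ-additive c (A≈B zero) (λ i j j≢c → sym (replaceColumn-≢ A c rest i j j≢c)) A≡B₀+rest ⟩
  detℤ n (B zero) + detℤ n (replaceColumn A c rest)
    ≡⟨ cong (_+_ (detℤ n (B zero))) (detℤ-sumColumn c (B ∘ suc) rest≈B (replaceColumn-≡ A c rest)) ⟩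
  detℤ n (B zero) + sum (λ k → detℤ n (B (suc k)))
    ∎
  where
  open ≡-Reasoning
  rest : Vector ℤ n
  rest i = sum (λ k → B (suc k) i c)
  A≡B₀+rest : ∀ i → A i c ≡ B zero i c + replaceColumn A c rest i c
  A≡B₀+rest i = trans (A≡∑B i) (cong (_+_ (B zero i c)) (sym (replaceColumn-≡ A c rest i)))
  rest≈B : ∀ k → AgreeOutside c (replaceColumn A c rest) (B (suc k))
  rest≈B k i j j≢c = trans (replaceColumn-≢ A c rest i j j≢c) (A≈B (suc k) i j j≢c)

data Adjacent : ∀ {n} → Fin n → Fin n → Set where
  zero-one : Adjacent {suc (suc n)} zero (suc zero)
  suc-suc : ∀ {p q : Fin n} → Adjacent p q → Adjacent (suc p) (suc q)

adjacent-toℕ : ∀ {p q : Fin n} → Adjacent p q → toℕ q ≡ suc (toℕ p)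
adjacent-toℕ zero-one = refl
adjacent-toℕ (suc-suc adj) = cong suc (adjacent-toℕ adj)

adjacent⁺-< : ∀ {p q : Fin n} → TransClosure Adjacent p q → toℕ p < toℕ q
adjacent⁺-< [ adj ] = ℕₚ.≤-reflexive (sym (adjacent-toℕ adj))
adjacent⁺-< (adj ∷ adj⁺) = ℕₚ.<-trans (ℕₚ.≤-reflexive (sym (adjacent-toℕ adj))) (adjacent⁺-< adj⁺)

adjacent⁺-≢ : ∀ {p q : Fin n} → TransClosure Adjacent p q → q ≢ p
adjacent⁺-≢ adj⁺ q≡p = ℕₚ.<-irrefl (cong toℕ (sym q≡p)) (adjacent⁺-< adj⁺)

suc-suc⁺ : ∀ {p q : Fin n} → TransClosure Adjacent p q → TransClosure Adjacent (suc p) (suc q)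
suc-suc⁺ [ adj ] = [ suc-suc adj ]
suc-suc⁺ (adj ∷ adj⁺) = suc-suc adj ∷ suc-suc⁺ adj⁺

zero-adjacent⁺-suc : ∀ (j : Fin n) → TransClosure Adjacent zero (suc j)
zero-adjacent⁺-suc zero = [ zero-one ]
zero-adjacent⁺-suc (suc j) = zero-one ∷ suc-suc⁺ (zero-adjacent⁺-suc j)

punchIn-adjacent : ∀ {p q : Fin (suc n)} → Adjacent p q → ∀ b →
                   punchIn p b ≡ punchIn q b ⊎ (punchIn p b ≡ q × punchIn q b ≡ p)
punchIn-adjacent zero-one zero = inj₂ (refl , refl)
punchIn-adjacent zero-one (suc b) = inj₁ refl
punchIn-adjacent (suc-suc adj) zero = inj₁ refl
punchIn-adjacent (suc-suc adj) (suc b) with punchIn-adjacent adj b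
... | inj₁ eq = inj₁ (cong suc eq)
... | inj₂ (eq₁ , eq₂) = inj₂ (cong suc eq₁ , cong suc eq₂)

punchOut-adjacent : ∀ {p q k : Fin (suc n)} → Adjacent p q → (k≢p : k ≢ p) (k≢q : k ≢ q) →
                    Adjacent (punchOut k≢p) (punchOut k≢q)
punchOut-adjacent {k = zero} zero-one k≢p k≢q = ⊥-elim (k≢p refl)
punchOut-adjacent {k = suc zero} zero-one k≢p k≢q = ⊥-elim (k≢q refl)
punchOut-adjacent {k = suc (suc zero)} zero-one k≢p k≢q = zero-one
punchOut-adjacent {k = suc (suc (suc k))} zero-one k≢p k≢q = zero-one
punchOut-adjacent {k = zero} (suc-suc adj) k≢p k≢q = adj
punchOut-adjacent {k = suc k} (suc-suc zero-one) k≢p k≢q =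
  suc-suc (punchOut-adjacent zero-one (k≢p ∘ cong suc) (k≢q ∘ cong suc))
punchOut-adjacent {k = suc k} (suc-suc (suc-suc adj)) k≢p k≢q =
  suc-suc (punchOut-adjacent (suc-suc adj) (k≢p ∘ cong suc) (k≢q ∘ cong suc))

-- Expanding along the first row, the minors at the two equal columns coincide and their signs differ;
-- every other minor still has two adjacent equal columns.
detℤ-adjacentEqualColumns : ∀ {A : Matrix n} {p q} → Adjacent p q → (∀ i → A i p ≡ A i q) → detℤ n A ≡ 0ℤ
detℤ-adjacentEqualColumns {suc n} {A} {p} {q} adj Ap≡Aq = begin
  detℤ (suc n) A    ≡⟨ sum-pair term (adjacent⁺-≢ [ adj ] ∘ sym) other-terms ⟩
  term p + term q   ≡⟨ terms-cancel ⟩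
  0ℤ                ∎
  where
  open ≡-Reasoning
  term : Fin (suc n) → ℤ
  term k = -1ℤ ℤ.^ toℕ k * (A zero k * detℤ n (minor A k))
  other-terms : ∀ k → k ≢ p → k ≢ q → term k ≡ 0ℤ
  other-terms k k≢p k≢q = begin
    term k                             ≡⟨ cong (λ d → -1ℤ ℤ.^ toℕ k * (A zero k * d)) minor-vanishes ⟩
    -1ℤ ℤ.^ toℕ k * (A zero k * 0ℤ)    ≡⟨ cong (-1ℤ ℤ.^ toℕ k *_) (ℤₚ.*-zeroʳ (A zero k)) ⟩
    -1ℤ ℤ.^ toℕ k * 0ℤ                 ≡⟨ ℤₚ.*-zeroʳ (-1ℤ ℤ.^ toℕ k) ⟩
    0ℤ                                 ∎
    where
    minor-vanishes : detℤ n (minor A k) ≡ 0ℤ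
    minor-vanishes = detℤ-adjacentEqualColumns (punchOut-adjacent adj k≢p k≢q) (λ a →
      trans (cong (A (suc a)) (punchIn-punchOut k≢p))
            (trans (Ap≡Aq (suc a)) (cong (A (suc a)) (sym (punchIn-punchOut k≢q)))))
  columns-match : ∀ a {b} → punchIn p b ≡ punchIn q b ⊎ (punchIn p b ≡ q × punchIn q b ≡ p) →
                  A (suc a) (punchIn p b) ≡ A (suc a) (punchIn q b)
  columns-match a (inj₁ eq) = cong (A (suc a)) eq
  columns-match a (inj₂ (eq₁ , eq₂)) rewrite eq₁ | eq₂ = sym (Ap≡Aq (suc a))
  same-minors : detℤ n (minor A p) ≡ detℤ n (minor A q)
  same-minors = detℤ-cong (λ a b → columns-match a (punchIn-adjacent adj b))
  e : ∀ σ x → σ * x + -1ℤ * σ * x ≡ 0ℤ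
  e = solve-∀
  terms-cancel : term p + term q ≡ 0ℤ
  terms-cancel rewrite adjacent-toℕ adj | sym (Ap≡Aq zero) | sym same-minors =
    e (-1ℤ ℤ.^ toℕ p) (A zero p * detℤ n (minor A p))

swapColumns : Fin n → Fin n → Matrix n → Matrix n
swapColumns p q A = replaceColumn (replaceColumn A p (column A q)) q (column A p)

-- Replacing both columns p and q by their sum a + b gives a vanishing determinant; expanding it
-- bilinearly leaves det A + det (swapColumns p q A), the other two terms having equal columns.
detℤ-swapAdjacentColumns : ∀ {A : Matrix n} {p q} → Adjacent p q → detℤ n (swapColumns p q A) ≡ - detℤ n A
detℤ-swapAdjacentColumns {n} {A} {p} {q} adj = inverseʳ-unique (detℤ n A) (detℤ n (M b a)) (begin
  detℤ n A + detℤ n (M b a)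
    ≡⟨ cong (_+ detℤ n (M b a)) (detℤ-cong Mab≡A) ⟨
  detℤ n (M a b) + detℤ n (M b a)
    ≡⟨ cong₂ _+_ (ℤₚ.+-identityˡ (detℤ n (M a b))) (ℤₚ.+-identityʳ (detℤ n (M b a))) ⟨
  (0ℤ + detℤ n (M a b)) + (detℤ n (M b a) + 0ℤ)
    ≡⟨ cong₂ (λ x y → (x + detℤ n (M a b)) + (detℤ n (M b a) + y)) (vanishes a) (vanishes b) ⟨
  (detℤ n (M a a) + detℤ n (M a b)) + (detℤ n (M b a) + detℤ n (M b b))
    ≡⟨ cong₂ _+_ (additive-at-q a) (additive-at-q b) ⟨
  detℤ n (M a a+b) + detℤ n (M b a+b)
    ≡⟨ additive-at-p ⟨
  detℤ n (M a+b a+b)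
    ≡⟨ vanishes a+b ⟩
  0ℤ
    ∎)
  where
  open ≡-Reasoning
  a b a+b : Vector ℤ n
  a = column A p
  b = column A q
  a+b i = a i + b i
  M : Vector ℤ n → Vector ℤ n → Matrix n
  M u w = replaceColumn (replaceColumn A p u) q w
  q≢p : q ≢ p
  q≢p = adjacent⁺-≢ [ adj ]
  M-at-p : ∀ u w i → M u w i p ≡ u i
  M-at-p u w i = trans (replaceColumn-≢ _ q w i p (q≢p ∘ sym)) (replaceColumn-≡ A p u i)
  M-at-q : ∀ u w i → M u w i q ≡ w i
  M-at-q u w i = replaceColumn-≡ _ q w i
  M-agree-p : ∀ u u′ w → AgreeOutside p (M u w) (M u′ w)
  M-agree-p u u′ w i j j≢p = by-cases (j ≟ q)
    where
    by-cases : Dec (j ≡ q) → M u w i j ≡ M u′ w i j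
    by-cases (yes j≡q) =
      subst (λ j → M u w i j ≡ M u′ w i j) (sym j≡q) (trans (M-at-q u w i) (sym (M-at-q u′ w i)))
    by-cases (no j≢q) = begin
      M u w i j                    ≡⟨ replaceColumn-≢ _ q w i j j≢q ⟩
      replaceColumn A p u i j      ≡⟨ replaceColumn-≢ A p u i j j≢p ⟩
      A i j                        ≡⟨ replaceColumn-≢ A p u′ i j j≢p ⟨
      replaceColumn A p u′ i j     ≡⟨ replaceColumn-≢ _ q w i j j≢q ⟨
      M u′ w i j                   ∎
  M-agree-q : ∀ u w w′ → AgreeOutside q (M u w) (M u w′)
  M-agree-q u w w′ i j j≢q = trans (replaceColumn-≢ _ q w i j j≢q) (sym (replaceColumn-≢ _ q w′ i j j≢q))
  vanishes : ∀ u → detℤ n (M u u) ≡ 0ℤ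
  vanishes u = detℤ-adjacentEqualColumns adj (λ i → trans (M-at-p u u i) (sym (M-at-q u u i)))
  additive-at-p : detℤ n (M a+b a+b) ≡ detℤ n (M a a+b) + detℤ n (M b a+b)
  additive-at-p = detℤ-additive p (M-agree-p a+b a a+b) (M-agree-p a+b b a+b)
    (λ i → trans (M-at-p a+b a+b i) (sym (cong₂ _+_ (M-at-p a a+b i) (M-at-p b a+b i))))
  additive-at-q : ∀ u → detℤ n (M u a+b) ≡ detℤ n (M u a) + detℤ n (M u b)
  additive-at-q u = detℤ-additive q (M-agree-q u a+b a) (M-agree-q u a+b b)
    (λ i → trans (M-at-q u a+b i) (sym (cong₂ _+_ (M-at-q u a i) (M-at-q u b i))))
  Mab≡A : ∀ i j → M a b i j ≡ A i j
  Mab≡A i j = trans (replaceColumn-self _ q b (λ i → sym (replaceColumn-self A p a (λ _ → refl) i q)) i j)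
                    (replaceColumn-self A p a (λ _ → refl) i j)

detℤ-equalColumns : ∀ {A : Matrix n} {p q} → TransClosure Adjacent p q → (∀ i → A i p ≡ A i q) →
                    detℤ n A ≡ 0ℤ
detℤ-equalColumns [ adj ] Ap≡Aq = detℤ-adjacentEqualColumns adj Ap≡Aq
detℤ-equalColumns {n} {A} {p} {q} (_∷_ {y = r} adj r⁺q) Ap≡Aq = begin
  detℤ n A                       ≡⟨ ℤₚ.neg-involutive (detℤ n A) ⟨
  - - detℤ n A                   ≡⟨ cong -_ (detℤ-swapAdjacentColumns adj) ⟨
  - detℤ n (swapColumns p r A)   ≡⟨ cong -_ (detℤ-equalColumns r⁺q Br≡Bq) ⟩
  - 0ℤ                           ∎
  where
  open ≡-Reasoning
  Br≡Bq : ∀ i → swapColumns p r A i r ≡ swapColumns p r A i q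
  Br≡Bq i = begin
    swapColumns p r A i r                ≡⟨ replaceColumn-≡ _ r (column A p) i ⟩
    A i p                                ≡⟨ Ap≡Aq i ⟩
    A i q                                ≡⟨ replaceColumn-≢ A p (column A r) i q (adjacent⁺-≢ (adj ∷ r⁺q)) ⟨
    replaceColumn A p (column A r) i q   ≡⟨ replaceColumn-≢ _ r (column A p) i q (adjacent⁺-≢ r⁺q) ⟨
    swapColumns p r A i q                ∎

-- Replacing column 0 by the sum of all columns gives a zero column; by linearity in that column its
-- determinant is det A plus determinants with column 0 equal to another column.
detℤ-rowSumsZero : 0 < n → ∀ (A : Matrix n) → (∀ i → sum (A i) ≡ 0ℤ) → detℤ n A ≡ 0ℤ
detℤ-rowSumsZero {suc n} _ A ∑A≡0 = begin
  detℤ (suc n) A                     ≡⟨ detℤ-cong (replaceColumn-self A zero (column A zero) (λ _ → refl)) ⟨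
  detℤ (suc n) (B zero)              ≡⟨ ℤₚ.+-identityʳ _ ⟨
  detℤ (suc n) (B zero) + 0ℤ         ≡⟨ cong (_+_ (detℤ (suc n) (B zero))) (sum-zero _ other-columns) ⟨
  sum (λ j → detℤ (suc n) (B j))     ≡⟨ detℤ-sumColumn {A = S} zero B S≈B S≡∑B ⟨
  detℤ (suc n) S                     ≡⟨ detℤ-zeroColumn {A = S} zero S-zeroColumn ⟩
  0ℤ                                 ∎
  where
  open ≡-Reasoning
  rowSum : Vector ℤ (suc n)
  rowSum i = sum (A i)
  S : Matrix (suc n)
  S = replaceColumn A zero rowSum
  B : Fin (suc n) → Matrix (suc n)
  B j = replaceColumn A zero (column A j)
  S-zeroColumn : ∀ i → S i zero ≡ 0ℤ
  S-zeroColumn i = trans (replaceColumn-≡ A zero rowSum i) (∑A≡0 i)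
  S≈B : ∀ j → AgreeOutside zero S (B j)
  S≈B j i k k≢0 =
    trans (replaceColumn-≢ A zero rowSum i k k≢0) (sym (replaceColumn-≢ A zero (column A j) i k k≢0))
  S≡∑B : ∀ i → S i zero ≡ sum (λ j → B j i zero)
  S≡∑B i =
    trans (replaceColumn-≡ A zero rowSum i) (sum-cong-≗ (λ j → sym (replaceColumn-≡ A zero (column A j) i)))
  other-columns : ∀ j → detℤ (suc n) (B (suc j)) ≡ 0ℤ
  other-columns j = detℤ-equalColumns {A = B (suc j)} (zero-adjacent⁺-suc j) (λ i →
    trans (replaceColumn-≡ A zero (column A (suc j)) i)
          (sym (replaceColumn-≢ A zero (column A (suc j)) i (suc j) (λ ()))))

-- The Iwasawa polynomial

sumFinᵃ-at : ∀ n (x : Fin n → Adic) l → sumFinᵃ n x l ≡ sum (λ i → x i l)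
sumFinᵃ-at zero x l = refl
sumFinᵃ-at (suc n) x l = cong (_+_ (x zero l)) (sumFinᵃ-at n (x ∘ suc) l)

sumFinₛ-at : ∀ n (f : Fin n → Series) k l → sumFinₛ n f k l ≡ sum (λ i → f i k l)
sumFinₛ-at zero f k l = refl
sumFinₛ-at (suc n) f k l = cong (_+_ (f zero k l)) (sumFinₛ-at n (f ∘ suc) k l)

alt-at : ∀ j f k l → alt j f k l ≡ -1ℤ ℤ.^ j * f k l
alt-at zero f k l = sym (ℤₚ.*-identityˡ (f k l))
alt-at (suc j) f k l = begin
  - alt j f k l                  ≡⟨ cong -_ (alt-at j f k l) ⟩
  - (-1ℤ ℤ.^ j * f k l)          ≡⟨ ℤₚ.-1*i≡-i (-1ℤ ℤ.^ j * f k l) ⟨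
  -1ℤ * (-1ℤ ℤ.^ j * f k l)      ≡⟨ ℤₚ.*-assoc -1ℤ (-1ℤ ℤ.^ j) (f k l) ⟨
  -1ℤ ℤ.^ suc j * f k l          ∎
  where open ≡-Reasoning

det-constantTerm : ∀ n (M : Fin n → Fin n → Series) l → det n M 0 l ≡ detℤ n (λ i j → M i j 0 l)
det-constantTerm zero M l = refl
det-constantTerm (suc n) M l = trans (sumFinₛ-at (suc n) expansion 0 l) (sum-cong-≗ term)
  where
  expansion : Fin (suc n) → Series
  expansion j = alt (toℕ j) (M zero j *ₛ det n (λ a b → M (suc a) (punchIn j b)))
  term : ∀ j → expansion j 0 l ≡ -1ℤ ℤ.^ toℕ j * (M zero j 0 l * detℤ n (minor (λ a b → M a b 0 l) j))
  term j = trans (alt-at (toℕ j) _ 0 l) (cong (-1ℤ ℤ.^ toℕ j *_)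
    (trans (ℤₚ.+-identityʳ _)
           (cong (M zero j 0 l *_) (det-constantTerm n (λ a b → M (suc a) (punchIn j b)) l))))

divideByT : Series → Series
divideByT f k = f (suc k)

T*divideByT : ∀ f → (∀ l → f 0 l ≡ 0ℤ) → ∀ k l → (Tₛ *ₛ divideByT f) k l ≡ f k l
T*divideByT f f₀≡0 zero l = begin
  0ℤ * f 1 l + 0ℤ   ≡⟨ ℤₚ.+-identityʳ _ ⟩
  0ℤ * f 1 l        ≡⟨ ℤₚ.*-zeroˡ (f 1 l) ⟩
  0ℤ                ≡⟨ f₀≡0 l ⟨
  f 0 l             ∎
  where open ≡-Reasoning
T*divideByT f f₀≡0 (suc k) l = begin
  0ℤ * f (suc (suc k)) l + (1ℤ * f (suc k) l + sumFinᵃ k higher l)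
    ≡⟨ cong₂ (λ u v → u + (1ℤ * f (suc k) l + v)) (ℤₚ.*-zeroˡ (f (suc (suc k)) l)) higher≡0 ⟩
  0ℤ + (1ℤ * f (suc k) l + 0ℤ)
    ≡⟨ trans (ℤₚ.+-identityˡ _) (trans (ℤₚ.+-identityʳ _) (ℤₚ.*-identityˡ _)) ⟩
  f (suc k) l
    ∎
  where
  open ≡-Reasoning
  higher : Fin k → Adic
  higher i = Tₛ (toℕ (suc (suc i))) *ᵃ divideByT f (suc k ℕ.∸ toℕ (suc (suc i)))
  higher≡0 : sumFinᵃ k higher l ≡ 0ℤ
  higher≡0 = trans (sumFinᵃ-at k higher l)
    (sum-zero (λ i → higher i l) (λ i → ℤₚ.*-zeroˡ (f (suc (k ℕ.∸ toℕ i)) l)))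

≡⇒Eqₛ : ∀ {ℓ f h} → (∀ k l → f k l ≡ h k l) → Eqₛ ℓ f h
≡⇒Eqₛ {ℓ} f≡h k l = ∣⇒∣ᵤ (divides-difference (mod-reflexive {M = + (ℓ ^ l)} (f≡h k l)))

indicator : Bool → ℤ
indicator b = if b then 1ℤ else 0ℤ

≟-diag : (i : Fin n) → ⌊ i ≟ i ⌋ ≡ true
≟-diag i = trans (isYes≗does (i ≟ i)) (dec-true (i ≟ i) refl)

≟-offDiag : (i k : Fin n) → k ≢ i → ⌊ i ≟ k ⌋ ≡ false
≟-offDiag i k k≢i = trans (isYes≗does (i ≟ k)) (dec-false (i ≟ k) (k≢i ∘ sym))

sum-indicator-≟ : ∀ b (t : Fin n) → sum (λ j → indicator (b ∧ ⌊ t ≟ j ⌋)) ≡ indicator b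
sum-indicator-≟ {n} false t = sum-zero {n} _ (λ _ → refl)
sum-indicator-≟ true t =
  trans (sum-single _ t (λ k k≢t → cong indicator (≟-offDiag t k k≢t))) (cong indicator (≟-diag t))

module _ (X : Multigraph) where
  open Multigraph X

  countFin-sum : ∀ n (p : Fin n → Bool) → + countFin X n p ≡ sum (indicator ∘ p)
  countFin-sum zero p = refl
  countFin-sum (suc n) p = cong₂ _+_ (indicator-ℕ (p zero)) (countFin-sum n (p ∘ suc))
    where
    indicator-ℕ : ∀ b → + (if b then 1 else 0) ≡ indicator b
    indicator-ℕ true = refl
    indicator-ℕ false = refl

  degreeTerm : Fin g → Fin g → ℤ
  degreeTerm i j = if ⌊ i ≟ j ⌋ then + deg X i else 0ℤ

  edgeCount : Fin g → Fin g → ℤ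
  edgeCount i j = sum (λ e → indicator (⌊ o e ≟ i ⌋ ∧ ⌊ t e ≟ j ⌋))

  degreeTerm-rowSum : ∀ i → sum (degreeTerm i) ≡ + deg X i
  degreeTerm-rowSum i =
    trans (sum-single _ i (λ k k≢i → cong (λ b → if b then + deg X i else 0ℤ) (≟-offDiag i k k≢i)))
          (cong (λ b → if b then + deg X i else 0ℤ) (≟-diag i))

  edgeCount-rowSum : ∀ i → sum (edgeCount i) ≡ + deg X i
  edgeCount-rowSum i = begin
    sum (edgeCount i)
      ≡⟨ ∑-comm (λ j e → indicator (⌊ o e ≟ i ⌋ ∧ ⌊ t e ≟ j ⌋)) ⟩
    sum (λ e → sum (λ j → indicator (⌊ o e ≟ i ⌋ ∧ ⌊ t e ≟ j ⌋)))
      ≡⟨ sum-cong-≗ (λ e → sum-indicator-≟ ⌊ o e ≟ i ⌋ (t e)) ⟩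
    sum (λ e → indicator ⌊ o e ≟ i ⌋)
      ≡⟨ countFin-sum m (λ e → ⌊ o e ≟ i ⌋) ⟨
    + deg X i
      ∎
    where open ≡-Reasoning

  module _ (α : Fin m → Adic) where

    iwasawaMatrix-constantTerm : ∀ l i j → iwasawaMatrix X α i j 0 l ≡ degreeTerm i j - edgeCount i j
    iwasawaMatrix-constantTerm l i j = cong₂ _-_ (degree ⌊ i ≟ j ⌋)
      (trans (sumFinₛ-at m _ 0 l) (sum-cong-≗ (λ e → edge (⌊ o e ≟ i ⌋ ∧ ⌊ t e ≟ j ⌋) e)))
      where
      degree : ∀ b → constₛ (if b then ofℕᵃ (deg X i) else 0ᵃ) 0 l ≡ (if b then + deg X i else 0ℤ)
      degree true = refl
      degree false = refl
      edge : ∀ b e → (if b then onePlusTPow (α e) else 0ₛ) 0 l ≡ indicator b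
      edge true e = binomℤ-0 (α e (l ℕ.+ 0))
      edge false e = refl

    iwasawaMatrix-rowSum : ∀ l i → sum (λ j → iwasawaMatrix X α i j 0 l) ≡ 0ℤ
    iwasawaMatrix-rowSum l i = begin
      sum (λ j → iwasawaMatrix X α i j 0 l)              ≡⟨ sum-cong-≗ (iwasawaMatrix-constantTerm l i) ⟩
      sum (λ j → degreeTerm i j - edgeCount i j)         ≡⟨ ∑-distrib-+ (degreeTerm i) (λ j → - edgeCount i j) ⟩
      sum (degreeTerm i) + sum (λ j → - edgeCount i j)   ≡⟨ cong₂ _+_ (degreeTerm-rowSum i) (sum-neg (edgeCount i)) ⟩
      + deg X i - sum (edgeCount i)                      ≡⟨ cong (_-_ (+ deg X i)) (edgeCount-rowSum i) ⟩
      + deg X i - + deg X i                              ≡⟨ ℤₚ.+-inverseʳ (+ deg X i) ⟩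
      0ℤ                                                 ∎
      where open ≡-Reasoning

    iwasawaPoly-constantTerm : 0 < g → ∀ l → iwasawaPoly X α 0 l ≡ 0ℤ
    iwasawaPoly-constantTerm g>0 l =
      trans (det-constantTerm g (iwasawaMatrix X α) l) (detℤ-rowSumsZero g>0 _ (iwasawaMatrix-rowSum l))

    iwasawaPoly-coherent : ∀ {ℓ} → (∀ e → IsAdic ℓ (α e)) → Coherentₛ ℓ (iwasawaPoly X α)
    iwasawaPoly-coherent {ℓ} α-adic = coherentₛ-det g (λ i j →
      coherentₛ-+ (coherentₛ-const (degree ⌊ i ≟ j ⌋))
        (coherentₛ-neg (coherentₛ-sumFin m (λ e → edge (⌊ o e ≟ i ⌋ ∧ ⌊ t e ≟ j ⌋) e))))
      where
      degree : ∀ {i} b → Coherent ℓ (if b then ofℕᵃ (deg X i) else 0ᵃ)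
      degree {i} true = coherent-const (+ deg X i)
      degree false = coherent-const 0ℤ
      edge : ∀ b e → Coherentₛ ℓ (if b then onePlusTPow (α e) else 0ₛ)
      edge true e = coherent-binom {a = α e} (isAdic⇒coherent (α-adic e))
      edge false e = coherentₛ-0

lemma3p6 : (ℓ : ℕ) → Prime ℓ → (X : Multigraph) → 0 < Multigraph.g X →
    (α : Fin (Multigraph.m X) → Adic) →
    (∀ e → IsAdic ℓ (α e)) →
    (∀ e → Eqᵃ ℓ (α (Multigraph.inv X e)) (-ᵃ α e)) →
    Σ Series (λ h → IsSeries ℓ h × Eqₛ ℓ (iwasawaPoly X α) (Tₛ *ₛ h))
lemma3p6 ℓ _ X g>0 α α-adic _ =
  divideByT f ,
  coherentₛ⇒isSeries (iwasawaPoly-coherent X α α-adic ∘ suc) ,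
  ≡⇒Eqₛ (λ k l → sym (T*divideByT f (iwasawaPoly-constantTerm X α g>0) k l))
  where
  f = iwasawaPoly X α
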